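{- Let $G=(V=L\cup R,E)$ be a bipartite graph and $W:E\to\mathbb{Z}$ edge weights that isolate a size-$k$ matching $M^k_{\mathrm{unique}}$ in $G$. Let $G_{\mathrm{residual}}$ and $W_{\mathrm{residual}}$ be the residual graph and residual weights with respect to $M=M^k_{\mathrm{unique}}$. Then $W$ isolates a size-$(k+1)$ matching in $G$ if and only if $W_{\mathrm{residual}}$ isolates an $s$-$t$ path in $G_{\mathrm{residual}}$.
   Context: A matching is a set of edges no two sharing an endpoint. For a family $\mathcal{F}$ of subsets of a set $U$ and weights $W$ on $U$ (extended additively to subsets), $W$ isolates $\mathcal{F}$ if exactly one member of $\mathcal{F}$ attains $\min_{F\in\mathcal{F}}W(F)$; "$W$ isolates a size-$j$ matching" means $W$ isolates the family of size-$j$ matchings of $G$, and "$W_{\mathrm{residual}}$ isolates an $s$-$t$ path" means it isolates the family of (edge sets of) $s$-$t$ paths. Residual graph of a matching $M$: the directed graph on $V\cup\{s,t\}$ ($s,t$ new) with, for $u\in L$, $v\in R$: an edge $s\to u$ if $u$ is unmatched by $M$; an edge $v\to t$ if $v$ is unmatched by $M$; an edge $v\to u$ if $(u,v)\in M$; an edge $u\to v$ if $(u,v)\in E\setminus M$. Residual weights: $W_{\mathrm{residual}}(e)=0$ for edges incident to $s$ or $t$, $W_{\mathrm{residual}}=-W(u,v)$ on the edge arising from $(u,v)\in M$, and $W_{\mathrm{residual}}=W(u,v)$ on the edge arising from $(u,v)\in E\setminus M$. -}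

module Defs where

open import Data.Nat using (ℕ; zero; suc)
import Data.Nat as ℕ
open import Data.Integer using (ℤ; _+_; -_; _≤_; 0ℤ)
open import Data.Fin using (Fin)
import Data.Fin as Fin
open import Data.Bool using (Bool; true; false; if_then_else_)
open import Data.List using (List; []; _∷_; _++_)
open import Data.List.Relation.Unary.Linked using (Linked)
open import Data.List.Relation.Unary.Unique.Propositional using (Unique)
open import Data.List.Membership.Propositional using (_∈_)
open import Data.Product using (Σ; _×_; _,_)
open import Data.Empty using (⊥)
open import Function.Bundles using (_⇔_)
open import Relation.Binary.PropositionalEquality using (_≡_)

IsolatedBy : {A : Set} (F : A → Set) (_≈_ : A → A → Set) (w : A → ℤ) (x : A) → Set
IsolatedBy {A} F _≈_ w x =
  F x × (∀ y → F y → w x ≤ w y) × (∀ y → F y → w y ≡ w x → y ≈ x)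

Isolates : {A : Set} (F : A → Set) (_≈_ : A → A → Set) (w : A → ℤ) → Set
Isolates {A} F _≈_ w = Σ A (IsolatedBy F _≈_ w)

-- Bipartite graphs: L = Fin a, R = Fin b, edge relation E ⊆ L × R.
-- Weights W : L → R → ℤ (only their values on edges matter).
-- An edge subset is a Boolean function on L × R.

EdgeSet : ℕ → ℕ → Set
EdgeSet a b = Fin a → Fin b → Bool

sumℤ : (n : ℕ) → (Fin n → ℤ) → ℤ
sumℤ zero f = 0ℤ
sumℤ (suc n) f = f Fin.zero + sumℤ n (λ i → f (Fin.suc i))

sumℕ : (n : ℕ) → (Fin n → ℕ) → ℕ
sumℕ zero f = 0
sumℕ (suc n) f = f Fin.zero ℕ.+ sumℕ n (λ i → f (Fin.suc i))

size : {a b : ℕ} → EdgeSet a b → ℕ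
size {a} {b} M = sumℕ a (λ u → sumℕ b (λ v → if M u v then 1 else 0))

weight : {a b : ℕ} → (Fin a → Fin b → ℤ) → EdgeSet a b → ℤ
weight {a} {b} W M = sumℤ a (λ u → sumℤ b (λ v → if M u v then W u v else 0ℤ))

_≐_ : {a b : ℕ} → EdgeSet a b → EdgeSet a b → Set
M ≐ M' = ∀ u v → M u v ≡ M' u v

IsMatching : {a b : ℕ} (E : EdgeSet a b) (M : EdgeSet a b) → Set
IsMatching E M =
  (∀ u v → M u v ≡ true → E u v ≡ true) ×
  (∀ u v v' → M u v ≡ true → M u v' ≡ true → v ≡ v') ×
  (∀ u u' v → M u v ≡ true → M u' v ≡ true → u ≡ u')

SizeMatching : {a b : ℕ} (E : EdgeSet a b) (j : ℕ) → EdgeSet a b → Set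
SizeMatching E j M = IsMatching E M × size M ≡ j

data RV (a b : ℕ) : Set where
  s t : RV a b
  l   : Fin a → RV a b
  r   : Fin b → RV a b

REdge : {a b : ℕ} (E M : EdgeSet a b) → RV a b → RV a b → Set
REdge {a} {b} E M s     (l u) = ∀ (v : Fin b) → M u v ≡ false
REdge {a} {b} E M (r v) t     = ∀ (u : Fin a) → M u v ≡ false
REdge E M (r v) (l u) = M u v ≡ true
REdge E M (l u) (r v) = (E u v ≡ true) × (M u v ≡ false)
REdge E M _ _ = ⊥

Wres : {a b : ℕ} (W : Fin a → Fin b → ℤ) → RV a b → RV a b → ℤ
Wres W (r v) (l u) = - W u v
Wres W (l u) (r v) = W u v
Wres W _ _ = 0ℤ

pairs : {A : Set} → List A → List (A × A)
pairs [] = []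
pairs (x ∷ []) = []
pairs (x ∷ y ∷ xs) = (x , y) ∷ pairs (y ∷ xs)

-- an s-t path is given by its list of internal vertices `mid`;
-- its full vertex sequence is s ∷ mid ++ [ t ]
fullPath : {a b : ℕ} → List (RV a b) → List (RV a b)
fullPath mid = s ∷ mid ++ t ∷ []

IsSTPath : {a b : ℕ} (E M : EdgeSet a b) → List (RV a b) → Set
IsSTPath E M mid = Linked (REdge E M) (fullPath mid) × Unique (fullPath mid)

pathWeight : {a b : ℕ} (W : Fin a → Fin b → ℤ) → List (RV a b) → ℤ
pathWeight W mid = go (pairs (fullPath mid))
  where
  go : List _ → ℤ
  go [] = 0ℤ
  go ((x , y) ∷ ps) = Wres W x y + go ps

_≈ₚ_ : {a b : ℕ} → List (RV a b) → List (RV a b) → Set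
p ≈ₚ q = ∀ x y → ((x , y) ∈ pairs (fullPath p)) ⇔ ((x , y) ∈ pairs (fullPath q))

{-# OPTIONS --safe #-}
-- Augmenting M along an s-t path p of its residual graph flips the edges under the arcs
-- of p. The result M ⊕ p is a size-(k+1) matching of weight pathWeight p + weight M, and
-- paths with different arc sets give different matchings. Conversely, every size-(k+1)
-- matching M′ contains such a path p whose forward arcs lie in M′ and whose backward arcs
-- do not; then M′ ⊕ p is a size-k matching, so
--   weight M′ = pathWeight p + weight (M′ ⊕ p) ≥ pathWeight p + weight M,
-- with equality only if M′ ⊕ p = M, that is M′ = M ⊕ p. Hence p ↦ M ⊕ p carries minimal
-- paths to minimal matchings and back, and isolation transfers in both directions.
--
-- The path inside M′ is found by induction on |M|: take a left vertex u covered by an edge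
-- uv of M′ but exposed in M. If v is exposed in M, then s → u → v → t works. Otherwise
-- delete uv from M′ and the M-edge u″v from M, recurse, and if the path found starts at
-- u″, prefix it with u → v. Sizes are weights for unit edge weights, under which every
-- s-t path has weight 1.

module Submission where

open import Defs
open import Data.Bool using (Bool; true; false; not; if_then_else_)
open import Data.Bool.Properties using (not-involutive; not-¬; ¬-not) renaming (_≟_ to _≟ᵇ_)
open import Data.Empty using (⊥; ⊥-elim)
open import Data.List using (List; []; _∷_; _++_)
open import Data.List.Membership.Propositional using (_∈_; _∉_)
open import Data.List.Membership.Propositional.Properties using (∈-++⁻; ∈-++⁺ˡ)
open import Data.List.Relation.Unary.All as All using (All; []; _∷_)
open import Data.List.Relation.Unary.All.Properties using (¬Any⇒All¬)
open import Data.List.Relation.Unary.AllPairs using ([]; _∷_)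
open import Data.List.Relation.Unary.Any as Any using (here; there)
open import Data.List.Relation.Unary.Linked using (Linked; []; [-]; _∷_)
open import Data.List.Relation.Unary.Unique.Propositional using (Unique)
open import Data.Fin as Fin using (Fin; zero; suc)
open import Data.Fin.Properties using (punchInᵢ≢i; suc-injective; any?; all?) renaming (_≟_ to _≟ᶠ_)
open import Data.Integer as ℤ using (ℤ; 0ℤ; 1ℤ; +_; -_; _+_; _≤_)
import Data.Integer.Properties as ℤ
open import Data.Nat as ℕ using (ℕ; zero; suc; z≤n; s<s⁻¹)
import Data.Nat.Properties as ℕ
open import Data.Product as Product using (∃; _×_; _,_; proj₁; proj₂)
import Data.Product.Properties as ×
open import Data.Sum as Sum using (_⊎_; inj₁; inj₂)
open import Data.Sum.Function.Propositional using (_⊎-⇔_)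
open import Function.Base using (_∘_)
open import Function.Bundles using (_⇔_; mk⇔)
open import Relation.Binary.Definitions using (DecidableEquality)
open import Relation.Binary.PropositionalEquality
open import Relation.Nullary using (Dec; yes; no; ¬_; does; contradiction)
import Relation.Nullary.Decidable as Dec
open import Relation.Nullary.Decidable using (dec-true; dec-false; does-⇔; _⊎-dec_; _×-dec_)

open import Algebra.Properties.CommutativeMonoid.Sum ℤ.+-0-commutativeMonoid
  using (sum; sum-remove; sum-cong-≗)
open import Algebra.Properties.AbelianGroup ℤ.+-0-abelianGroup
  using (y≈x\\z; //-rightDividesʳ; ∙-cancelˡ)

private variable
  a b : ℕ

-- Transferring isolation along a correspondence

+-cancelʳ-≤ : ∀ c {i j : ℤ} → i + c ≤ j + c → i ≤ j
+-cancelʳ-≤ c {i} {j} le =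
  subst₂ _≤_ (//-rightDividesʳ c i) (//-rightDividesʳ c j) (ℤ.+-monoˡ-≤ (- c) le)

module _ {A B : Set} {F : A → Set} {G : B → Set} {_≈ᴬ_ : A → A → Set} {_≈ᴮ_ : B → B → Set}
         {wᴬ : A → ℤ} {wᴮ : B → ℤ} (c : ℤ) (f : B → A)
         (≈ᴬ-trans : ∀ {x y z} → x ≈ᴬ y → y ≈ᴬ z → x ≈ᴬ z)
         (f-maps : ∀ {y} → G y → F (f y))
         (f-weight : ∀ {y} → G y → wᴬ (f y) ≡ wᴮ y + c)
         (f-cong : ∀ {y y′} → y ≈ᴮ y′ → f y ≈ᴬ f y′)
         (f-injective : ∀ {y y′} → G y → G y′ → f y ≈ᴬ f y′ → y ≈ᴮ y′)
         (f-bound : ∀ {x} → F x →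
                    ∃ λ y → G y × wᴮ y + c ≤ wᴬ x × (wᴮ y + c ≡ wᴬ x → x ≈ᴬ f y)) where

  isolates-transfer : Isolates F _≈ᴬ_ wᴬ ⇔ Isolates G _≈ᴮ_ wᴮ
  isolates-transfer = mk⇔ to from
    where
    to : Isolates F _≈ᴬ_ wᴬ → Isolates G _≈ᴮ_ wᴮ
    to (x* , Fx* , x*-min , x*-unique) with f-bound Fx*
    ... | y* , Gy* , y*≤x* , y*-tight = y* , Gy* , y*-min , y*-unique
      where
      below : ∀ {y} → G y → wᴬ x* ≤ wᴮ y + c
      below Gy = subst (wᴬ x* ≤_) (f-weight Gy) (x*-min _ (f-maps Gy))
      y*-min : ∀ y → G y → wᴮ y* ≤ wᴮ y
      y*-min y Gy = +-cancelʳ-≤ c (ℤ.≤-trans y*≤x* (below Gy))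
      y*≡x* : wᴮ y* + c ≡ wᴬ x*
      y*≡x* = ℤ.≤-antisym y*≤x* (below Gy*)
      y*-unique : ∀ y → G y → wᴮ y ≡ wᴮ y* → y ≈ᴮ y*
      y*-unique y Gy eq = f-injective Gy Gy*
        (≈ᴬ-trans (x*-unique (f y) (f-maps Gy) (trans (f-weight Gy) (trans (cong (_+ c) eq) y*≡x*)))
                  (y*-tight y*≡x*))
    from : Isolates G _≈ᴮ_ wᴮ → Isolates F _≈ᴬ_ wᴬ
    from (y* , Gy* , y*-min , y*-unique) = f y* , f-maps Gy* , x-min , x-unique
      where
      x-min : ∀ x → F x → wᴬ (f y*) ≤ wᴬ x
      x-min x Fx with f-bound Fx
      ... | y , Gy , y≤x , _ =
        subst (_≤ wᴬ x) (sym (f-weight Gy*)) (ℤ.≤-trans (ℤ.+-monoˡ-≤ c (y*-min y Gy)) y≤x)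
      x-unique : ∀ x → F x → wᴬ x ≡ wᴬ (f y*) → x ≈ᴬ f y*
      x-unique x Fx eq with f-bound Fx
      ... | y , Gy , y≤x , y-tight =
        ≈ᴬ-trans (y-tight (trans (cong (_+ c) y≡y*) (sym x≡))) (f-cong (y*-unique y Gy y≡y*))
        where
        x≡ : wᴬ x ≡ wᴮ y* + c
        x≡ = trans eq (f-weight Gy*)
        y≡y* : wᴮ y ≡ wᴮ y*
        y≡y* = ℤ.≤-antisym (+-cancelʳ-≤ c (subst (wᴮ y + c ≤_) x≡ y≤x)) (y*-min y Gy)

sumℤ≡sum : ∀ n (f : Fin n → ℤ) → sumℤ n f ≡ sum f
sumℤ≡sum zero    f = refl
sumℤ≡sum (suc n) f = cong (_+_ (f zero)) (sumℤ≡sum n (f ∘ suc))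

sumℤ-cong : ∀ n {f g : Fin n → ℤ} → (∀ i → f i ≡ g i) → sumℤ n f ≡ sumℤ n g
sumℤ-cong n {f} {g} f≗g = begin
  sumℤ n f ≡⟨ sumℤ≡sum n f ⟩
  sum f    ≡⟨ sum-cong-≗ f≗g ⟩
  sum g    ≡⟨ sumℤ≡sum n g ⟨
  sumℤ n g ∎
  where open ≡-Reasoning

sumℤ-changeAt : ∀ n (f g : Fin n → ℤ) (i : Fin n) (d : ℤ) →
                (∀ j → j ≢ i → g j ≡ f j) → g i ≡ d + f i → sumℤ n g ≡ d + sumℤ n f
sumℤ-changeAt (suc n) f g i d g≗f gᵢ = begin
  sumℤ (suc n) g                        ≡⟨ sumℤ≡sum (suc n) g ⟩
  sum g                                 ≡⟨ sum-remove g ⟩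
  g i + sum (g ∘ Fin.punchIn i)         ≡⟨ cong₂ _+_ gᵢ (sum-cong-≗ (g≗f _ ∘ punchInᵢ≢i i)) ⟩
  d + f i + sum (f ∘ Fin.punchIn i)     ≡⟨ ℤ.+-assoc d (f i) _ ⟩
  d + (f i + sum (f ∘ Fin.punchIn i))   ≡⟨ cong (_+_ d) (sum-remove f) ⟨
  d + sum f                             ≡⟨ cong (_+_ d) (sumℤ≡sum (suc n) f) ⟨
  d + sumℤ (suc n) f                    ∎
  where open ≡-Reasoning

sumℤ-pos : ∀ n (f : Fin n → ℕ) → sumℤ n (λ i → + f i) ≡ + sumℕ n f
sumℤ-pos zero    f = refl
sumℤ-pos (suc n) f =
  trans (cong (_+_ (+ f zero)) (sumℤ-pos n (f ∘ suc))) (sym (ℤ.pos-+ (f zero) _))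

sumℕ-mono-≤ : ∀ n {f g : Fin n → ℕ} → (∀ i → f i ℕ.≤ g i) → sumℕ n f ℕ.≤ sumℕ n g
sumℕ-mono-≤ zero    _   = z≤n
sumℕ-mono-≤ (suc n) f≤g = ℕ.+-mono-≤ (f≤g zero) (sumℕ-mono-≤ n (f≤g ∘ suc))

sumℕ-≥ : ∀ n (f : Fin n → ℕ) (i : Fin n) → f i ℕ.≤ sumℕ n f
sumℕ-≥ (suc n) f zero    = ℕ.m≤m+n (f zero) _
sumℕ-≥ (suc n) f (suc i) = ℕ.≤-trans (sumℕ-≥ n (f ∘ suc) i) (ℕ.m≤n+m _ (f zero))

count : ∀ n → (Fin n → Bool) → ℕ
count n g = sumℕ n (λ i → if g i then 1 else 0)

count-none : ∀ n (g : Fin n → Bool) → (∀ i → g i ≡ false) → count n g ≡ 0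
count-none zero    g none = refl
count-none (suc n) g none rewrite none zero = count-none n (g ∘ suc) (none ∘ suc)

count-≤1 : ∀ n (g : Fin n → Bool) → (∀ i j → g i ≡ true → g j ≡ true → i ≡ j) →
           count n g ℕ.≤ 1
count-≤1 zero    g atMostOne = z≤n
count-≤1 (suc n) g atMostOne with g zero in g₀
... | true  = ℕ.≤-reflexive (cong suc (count-none n (g ∘ suc)
                (λ i → ¬-not (λ gᵢ → contradiction (atMostOne zero (suc i) g₀ gᵢ) λ ()))))
... | false = count-≤1 n (g ∘ suc) (λ i j gᵢ gⱼ → suc-injective (atMostOne (suc i) (suc j) gᵢ gⱼ))

weight-cong : (W : Fin a → Fin b → ℤ) {X Y : EdgeSet a b} → X ≐ Y → weight W X ≡ weight W Y
weight-cong {a} {b} W X≐Y =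
  sumℤ-cong a (λ u → sumℤ-cong b (λ v → cong (λ c → if c then W u v else 0ℤ) (X≐Y u v)))

weight-addEdge : (W : Fin a → Fin b → ℤ) {X Y : EdgeSet a b} (u : Fin a) (v : Fin b) →
                 (∀ u′ v′ → (u′ , v′) ≢ (u , v) → Y u′ v′ ≡ X u′ v′) →
                 X u v ≡ false → Y u v ≡ true → weight W Y ≡ W u v + weight W X
weight-addEdge {a} {b} W {X} {Y} u v Y≗X Xuv Yuv =
  sumℤ-changeAt a (λ u′ → sumℤ b (entry X u′)) (λ u′ → sumℤ b (entry Y u′)) u (W u v)
    (λ u′ u′≢u → sumℤ-cong b (λ v′ → entry-cong (Y≗X u′ v′ (u′≢u ∘ cong proj₁))))
    (sumℤ-changeAt b (entry X u) (entry Y u) v (W u v)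
      (λ v′ v′≢v → entry-cong (Y≗X u v′ (v′≢v ∘ cong proj₂)))
      (subst₂ (λ y x → (if y then W u v else 0ℤ) ≡ W u v + (if x then W u v else 0ℤ))
              (sym Yuv) (sym Xuv) (sym (ℤ.+-identityʳ (W u v)))))
  where
  entry : EdgeSet a b → Fin a → Fin b → ℤ
  entry Z u′ v′ = if Z u′ v′ then W u′ v′ else 0ℤ
  entry-cong : ∀ {u′ v′} → Y u′ v′ ≡ X u′ v′ → entry Y u′ v′ ≡ entry X u′ v′
  entry-cong {u′} {v′} = cong (λ c → if c then W u′ v′ else 0ℤ)

unitWeight : Fin a → Fin b → ℤ
unitWeight _ _ = 1ℤ

weight-unitWeight : (X : EdgeSet a b) → weight unitWeight X ≡ + size X
weight-unitWeight {a} {b} X =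
  trans (sumℤ-cong a (λ u → trans (sumℤ-cong b (λ v → indicator (X u v))) (sumℤ-pos b _)))
        (sumℤ-pos a _)
  where
  indicator : ∀ c → (if c then 1ℤ else 0ℤ) ≡ + (if c then 1 else 0)
  indicator true  = refl
  indicator false = refl

size-addEdge : {X Y : EdgeSet a b} (u : Fin a) (v : Fin b) →
               (∀ u′ v′ → (u′ , v′) ≢ (u , v) → Y u′ v′ ≡ X u′ v′) →
               X u v ≡ false → Y u v ≡ true → size Y ≡ suc (size X)
size-addEdge {X = X} {Y} u v Y≗X Xuv Yuv = ℤ.+-injective (begin
  + size Y                       ≡⟨ weight-unitWeight Y ⟨
  weight unitWeight Y            ≡⟨ weight-addEdge unitWeight u v Y≗X Xuv Yuv ⟩
  1ℤ + weight unitWeight X       ≡⟨ cong (_+_ 1ℤ) (weight-unitWeight X) ⟩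
  + suc (size X)                 ∎)
  where open ≡-Reasoning

size-cong : {X Y : EdgeSet a b} → X ≐ Y → size X ≡ size Y
size-cong {X = X} {Y} X≐Y = ℤ.+-injective
  (trans (sym (weight-unitWeight X)) (trans (weight-cong unitWeight X≐Y) (weight-unitWeight Y)))

≐-trans : {X Y Z : EdgeSet a b} → X ≐ Y → Y ≐ Z → X ≐ Z
≐-trans X≐Y Y≐Z u v = trans (X≐Y u v) (Y≐Z u v)

_≟ᵉ_ : DecidableEquality (Fin a × Fin b)
_≟ᵉ_ = ×.≡-dec _≟ᶠ_ _≟ᶠ_

_∖_ : EdgeSet a b → Fin a × Fin b → EdgeSet a b
(X ∖ e) u v = if does ((u , v) ≟ᵉ e) then false else X u v

∖-self : (X : EdgeSet a b) (u : Fin a) (v : Fin b) → (X ∖ (u , v)) u v ≡ false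
∖-self X u v rewrite dec-true ((u , v) ≟ᵉ (u , v)) refl = refl

∖-other : (X : EdgeSet a b) {e : Fin a × Fin b} {u : Fin a} {v : Fin b} →
          (u , v) ≢ e → (X ∖ e) u v ≡ X u v
∖-other X {e} {u} {v} uv≢e rewrite dec-false ((u , v) ≟ᵉ e) uv≢e = refl

∖-⊆ : (X : EdgeSet a b) (e : Fin a × Fin b) (u : Fin a) (v : Fin b) →
      (X ∖ e) u v ≡ true → X u v ≡ true
∖-⊆ X e u v with (u , v) ≟ᵉ e
... | yes _ = λ ()
... | no  _ = λ Xuv → Xuv

size-∖ : (X : EdgeSet a b) (u : Fin a) (v : Fin b) → X u v ≡ true → size X ≡ suc (size (X ∖ (u , v)))
size-∖ X u v Xuv = size-addEdge u v (λ _ _ ne → sym (∖-other X ne)) (∖-self X u v) Xuv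

IsMatching-⊆ : {E X Y : EdgeSet a b} → (∀ u v → Y u v ≡ true → X u v ≡ true) →
               IsMatching E X → IsMatching E Y
IsMatching-⊆ Y⊆X (X⊆E , leftUnique , rightUnique) =
  (λ u v → X⊆E u v ∘ Y⊆X u v) ,
  (λ u v v′ Yuv Yuv′ → leftUnique u v v′ (Y⊆X u v Yuv) (Y⊆X u v′ Yuv′)) ,
  (λ u u′ v Yuv Yu′v → rightUnique u u′ v (Y⊆X u v Yuv) (Y⊆X u′ v Yu′v))

module _ {A : Set} where

  pairs-Linked : {R : A → A → Set} {xs : List A} → Linked R xs → ∀ {x y} → (x , y) ∈ pairs xs → R x y
  pairs-Linked (Rxy ∷ _)    (here refl) = Rxy
  pairs-Linked (_   ∷ rest) (there xy)  = pairs-Linked rest xy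

  pairs-∈ˡ : ∀ xs {x y : A} → (x , y) ∈ pairs xs → x ∈ xs
  pairs-∈ˡ (x ∷ y ∷ xs) (here refl) = here refl
  pairs-∈ˡ (x ∷ y ∷ xs) (there xy)  = there (pairs-∈ˡ (y ∷ xs) xy)

  pairs-∈ʳ-tail : ∀ w xs {x y : A} → (x , y) ∈ pairs (w ∷ xs) → y ∈ xs
  pairs-∈ʳ-tail w (y ∷ xs) (here refl) = here refl
  pairs-∈ʳ-tail w (y ∷ xs) (there xy)  = there (pairs-∈ʳ-tail y xs xy)

  pairs-∈ʳ : ∀ xs {x y : A} → (x , y) ∈ pairs xs → y ∈ xs
  pairs-∈ʳ (w ∷ xs) xy = there (pairs-∈ʳ-tail w xs xy)

  pairs-functional : ∀ {xs} → Unique xs → ∀ {x y y′ : A} →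
                     (x , y) ∈ pairs xs → (x , y′) ∈ pairs xs → y ≡ y′
  pairs-functional {x ∷ y ∷ xs} _ (here refl) (here refl) = refl
  pairs-functional {x ∷ y ∷ xs} (x∉ ∷ _) (here refl) (there xy′) =
    ⊥-elim (All.lookup x∉ (pairs-∈ˡ (y ∷ xs) xy′) refl)
  pairs-functional {x ∷ y ∷ xs} (x∉ ∷ _) (there xy) (here refl) =
    ⊥-elim (All.lookup x∉ (pairs-∈ˡ (y ∷ xs) xy) refl)
  pairs-functional {x ∷ y ∷ xs} (_ ∷ uniq) (there xy) (there xy′) = pairs-functional uniq xy xy′

  pairs-injective : ∀ {xs} → Unique xs → ∀ {x x′ y : A} →
                    (x , y) ∈ pairs xs → (x′ , y) ∈ pairs xs → x ≡ x′
  pairs-injective {x ∷ y ∷ xs} _ (here refl) (here refl) = refl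
  pairs-injective {x ∷ y ∷ xs} (_ ∷ y∉ ∷ _) (here refl) (there x′y) =
    ⊥-elim (All.lookup y∉ (pairs-∈ʳ-tail y xs x′y) refl)
  pairs-injective {x ∷ y ∷ xs} (_ ∷ y∉ ∷ _) (there xy) (here refl) =
    ⊥-elim (All.lookup y∉ (pairs-∈ʳ-tail y xs xy) refl)
  pairs-injective {x ∷ y ∷ xs} (_ ∷ uniq) (there xy) (there x′y) = pairs-injective uniq xy x′y

  pairs-successor : ∀ xs (w : A) {x} → x ∈ xs → ∃ λ y → (x , y) ∈ pairs (xs ++ w ∷ [])
  pairs-successor (x ∷ [])     w (here refl) = w , here refl
  pairs-successor (x ∷ y ∷ xs) w (here refl) = y , here refl
  pairs-successor (_ ∷ y ∷ xs) w (there x∈) = Product.map₂ there (pairs-successor (y ∷ xs) w x∈)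

  pairs-predecessor : ∀ (w : A) xs {x} → x ∈ xs → ∃ λ y → (y , x) ∈ pairs (w ∷ xs)
  pairs-predecessor w (x ∷ xs) (here refl) = w , here refl
  pairs-predecessor w (y ∷ xs) (there x∈) = Product.map₂ there (pairs-predecessor y xs x∈)

  Linked-map∈ : {R S : A → A → Set} {xs : List A} →
                (∀ {x y} → (x , y) ∈ pairs xs → R x y → S x y) → Linked R xs → Linked S xs
  Linked-map∈ f []           = []
  Linked-map∈ f [-]          = [-]
  Linked-map∈ f (Rxy ∷ rest) = f (here refl) Rxy ∷ Linked-map∈ (f ∘ there) rest

  ∉-snoc : ∀ {x w : A} {xs} → x ∉ xs → x ≢ w → x ∉ xs ++ w ∷ []
  ∉-snoc {xs = xs} x∉ x≢w x∈ with ∈-++⁻ xs x∈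
  ... | inj₁ x∈xs        = x∉ x∈xs
  ... | inj₂ (here x≡w)  = x≢w x≡w

-- Residual arcs and flipping

l-injective : {u u′ : Fin a} → l {b = b} u ≡ l u′ → u ≡ u′
l-injective refl = refl

r-injective : {v v′ : Fin b} → r {a = a} v ≡ r v′ → v ≡ v′
r-injective refl = refl

_≟ᵛ_ : DecidableEquality (RV a b)
s   ≟ᵛ s    = yes refl
t   ≟ᵛ t    = yes refl
l u ≟ᵛ l u′ = Dec.map′ (cong l) l-injective (u ≟ᶠ u′)
r v ≟ᵛ r v′ = Dec.map′ (cong r) r-injective (v ≟ᶠ v′)
s   ≟ᵛ t    = no λ ()
s   ≟ᵛ l _  = no λ ()
s   ≟ᵛ r _  = no λ ()
t   ≟ᵛ s    = no λ ()
t   ≟ᵛ l _  = no λ ()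
t   ≟ᵛ r _  = no λ ()
l _ ≟ᵛ s    = no λ ()
l _ ≟ᵛ t    = no λ ()
l _ ≟ᵛ r _  = no λ ()
r _ ≟ᵛ s    = no λ ()
r _ ≟ᵛ t    = no λ ()
r _ ≟ᵛ l _  = no λ ()

Arc : ℕ → ℕ → Set
Arc a b = RV a b × RV a b

lr-injective : {u u′ : Fin a} {v v′ : Fin b} →
               _≡_ {A = Arc a b} (l u , r v) (l u′ , r v′) → (u , v) ≡ (u′ , v′)
lr-injective refl = refl

rl-injective : {u u′ : Fin a} {v v′ : Fin b} →
               _≡_ {A = Arc a b} (r v , l u) (r v′ , l u′) → (u , v) ≡ (u′ , v′)
rl-injective refl = refl

_∈ᵃ?_ : (q : Arc a b) (ps : List (Arc a b)) → Dec (q ∈ ps)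
q ∈ᵃ? ps = Any.any? (×.≡-dec _≟ᵛ_ _≟ᵛ_ q) ps

OnArcs : List (Arc a b) → Fin a → Fin b → Set
OnArcs ps u v = (l u , r v) ∈ ps ⊎ (r v , l u) ∈ ps

onArcs? : (ps : List (Arc a b)) (u : Fin a) (v : Fin b) → Dec (OnArcs ps u v)
onArcs? ps u v = ((l u , r v) ∈ᵃ? ps) ⊎-dec ((r v , l u) ∈ᵃ? ps)

_⊕_ : EdgeSet a b → List (Arc a b) → EdgeSet a b
(X ⊕ ps) u v = if does (onArcs? ps u v) then not (X u v) else X u v

module _ (X : EdgeSet a b) {ps : List (Arc a b)} {u : Fin a} {v : Fin b} where

  ⊕-on : OnArcs ps u v → (X ⊕ ps) u v ≡ not (X u v)
  ⊕-on on rewrite dec-true (onArcs? ps u v) on = refl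

  ⊕-off : ¬ OnArcs ps u v → (X ⊕ ps) u v ≡ X u v
  ⊕-off off rewrite dec-false (onArcs? ps u v) off = refl

  ⊕-true : (X ⊕ ps) u v ≡ true → (¬ OnArcs ps u v × X u v ≡ true) ⊎ (OnArcs ps u v × X u v ≡ false)
  ⊕-true X⊕ with onArcs? ps u v
  ... | yes on = inj₂ (on , trans (sym (not-involutive (X u v))) (cong not (trans (sym (⊕-on on)) X⊕)))
  ... | no off = inj₁ (off , trans (sym (⊕-off off)) X⊕)

⊕-cong : (X : EdgeSet a b) {ps qs : List (Arc a b)} {u : Fin a} {v : Fin b} →
         OnArcs ps u v ⇔ OnArcs qs u v → (X ⊕ ps) u v ≡ (X ⊕ qs) u v
⊕-cong X {ps} {qs} {u} {v} on⇔ =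
  cong (λ c → if c then not (X u v) else X u v) (does-⇔ on⇔ (onArcs? ps u v) (onArcs? qs u v))

⊕-congˡ : {X X′ : EdgeSet a b} (ps : List (Arc a b)) → X ≐ X′ → (X ⊕ ps) ≐ (X′ ⊕ ps)
⊕-congˡ ps X≐X′ u v = cong (λ c → if does (onArcs? ps u v) then not c else c) (X≐X′ u v)

⊕-reflects-OnArcs : (X : EdgeSet a b) {ps qs : List (Arc a b)} {u : Fin a} {v : Fin b} →
                    (X ⊕ ps) u v ≡ (X ⊕ qs) u v → OnArcs ps u v → OnArcs qs u v
⊕-reflects-OnArcs X {ps} {qs} {u} {v} eq on with onArcs? qs u v
... | yes on′ = on′
... | no off′ = contradiction (trans (sym (⊕-on X on)) (trans eq (⊕-off X off′))) (not-¬ refl ∘ sym)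

⊕-involutive : (X : EdgeSet a b) (ps : List (Arc a b)) → ((X ⊕ ps) ⊕ ps) ≐ X
⊕-involutive X ps u v with onArcs? ps u v
... | yes on = trans (⊕-on (X ⊕ ps) on) (trans (cong not (⊕-on X on)) (not-involutive (X u v)))
... | no off = trans (⊕-off (X ⊕ ps) off) (⊕-off X off)

⊕-∷-agree : (X : EdgeSet a b) {q : Arc a b} {ps : List (Arc a b)} {u : Fin a} {v : Fin b} →
            q ≢ (l u , r v) → q ≢ (r v , l u) → (X ⊕ (q ∷ ps)) u v ≡ (X ⊕ ps) u v
⊕-∷-agree X {q} {ps} {u} {v} q≢lr q≢rl = ⊕-cong X (mk⇔ drop (Sum.map there there))
  where
  drop : OnArcs (q ∷ ps) u v → OnArcs ps u v
  drop (inj₁ (here eq)) = contradiction (sym eq) q≢lr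
  drop (inj₁ (there m)) = inj₁ m
  drop (inj₂ (here eq)) = contradiction (sym eq) q≢rl
  drop (inj₂ (there m)) = inj₂ m

Oriented : EdgeSet a b → List (Arc a b) → Set
Oriented X ps = (∀ {u v} → (l u , r v) ∈ ps → X u v ≡ false) ×
                (∀ {u v} → (r v , l u) ∈ ps → X u v ≡ true)

Antioriented : EdgeSet a b → List (Arc a b) → Set
Antioriented X ps = (∀ {u v} → (l u , r v) ∈ ps → X u v ≡ true) ×
                    (∀ {u v} → (r v , l u) ∈ ps → X u v ≡ false)

⊕-Oriented : (X : EdgeSet a b) (ps : List (Arc a b)) → Antioriented X ps → Oriented (X ⊕ ps) ps
⊕-Oriented X ps (lr⊆X , rl⊈X) =
  (λ lr → trans (⊕-on X (inj₁ lr)) (cong not (lr⊆X lr))) ,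
  (λ rl → trans (⊕-on X (inj₂ rl)) (cong not (rl⊈X rl)))

arcs : List (RV a b) → List (Arc a b)
arcs p = pairs (fullPath p)

inner : (p : List (RV a b)) {x : RV a b} → x ∈ fullPath p → x ≢ s → x ≢ t → x ∈ p
inner p (here refl)  x≢s _ = contradiction refl x≢s
inner p (there x∈) _ x≢t with ∈-++⁻ p x∈
... | inj₁ x∈p       = x∈p
... | inj₂ (here eq) = contradiction eq x≢t

successor : (p : List (RV a b)) {x : RV a b} → x ∈ p → ∃ λ y → (x , y) ∈ arcs p
successor p x∈ = pairs-successor (s ∷ p) t (there x∈)

predecessor : (p : List (RV a b)) {x : RV a b} → x ∈ p → ∃ λ y → (y , x) ∈ arcs p
predecessor p x∈ = pairs-predecessor s (p ++ t ∷ []) (∈-++⁺ˡ x∈)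

OnArcs-l∈ : ∀ xs {u : Fin a} {v : Fin b} → OnArcs (pairs xs) u v → l u ∈ xs
OnArcs-l∈ xs (inj₁ lr) = pairs-∈ˡ xs lr
OnArcs-l∈ xs (inj₂ rl) = pairs-∈ʳ xs rl

OnArcs-r∈ : ∀ xs {u : Fin a} {v : Fin b} → OnArcs (pairs xs) u v → r v ∈ xs
OnArcs-r∈ xs (inj₁ lr) = pairs-∈ʳ xs lr
OnArcs-r∈ xs (inj₂ rl) = pairs-∈ˡ xs rl

-- The two path edges at a vertex come from a forward and a backward arc, so by alternation
-- at most one of them lies outside X; an X-edge at a path vertex is on the path (cover),
-- hence flipped away.
module _ {E X : EdgeSet a b} {xs : List (RV a b)} (uniq : Unique xs) (isMatching : IsMatching E X)
  (arcs⊆E : ∀ {u v} → OnArcs (pairs xs) u v → E u v ≡ true)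
  (coverˡ : ∀ {u v} → X u v ≡ true → l u ∈ xs → OnArcs (pairs xs) u v)
  (coverʳ : ∀ {u v} → X u v ≡ true → r v ∈ xs → OnArcs (pairs xs) u v)
  (alternates : Oriented X (pairs xs) ⊎ Antioriented X (pairs xs)) where

  private
    ps : List (Arc a b)
    ps = pairs xs

    noArcPairOutside : ∀ {u u′ v v′} → (l u , r v) ∈ ps → (r v′ , l u′) ∈ ps →
                       X u v ≡ false → X u′ v′ ≡ false → ⊥
    noArcPairOutside lr rl Xuv Xu′v′ = Sum.[
      (λ oriented → contradiction (trans (sym (proj₂ oriented rl)) Xu′v′) λ ()) ,
      (λ antioriented → contradiction (trans (sym (proj₁ antioriented lr)) Xuv) λ ()) ] alternates

  ⊕-isMatching : IsMatching E (X ⊕ ps)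
  ⊕-isMatching = ⊆E , leftUnique , rightUnique
    where
    ⊆E : ∀ u v → (X ⊕ ps) u v ≡ true → E u v ≡ true
    ⊆E u v X⊕uv with ⊕-true X X⊕uv
    ... | inj₁ (_ , Xuv) = proj₁ isMatching u v Xuv
    ... | inj₂ (on , _)  = arcs⊆E on

    leftUnique : ∀ u v v′ → (X ⊕ ps) u v ≡ true → (X ⊕ ps) u v′ ≡ true → v ≡ v′
    leftUnique u v v′ X⊕uv X⊕uv′ with ⊕-true X X⊕uv | ⊕-true X X⊕uv′
    ... | inj₁ (_ , Xuv) | inj₁ (_ , Xuv′) = proj₁ (proj₂ isMatching) u v v′ Xuv Xuv′
    ... | inj₁ (off , Xuv) | inj₂ (on′ , _) = contradiction (coverˡ Xuv (OnArcs-l∈ xs on′)) off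
    ... | inj₂ (on , _) | inj₁ (off′ , Xuv′) = contradiction (coverˡ Xuv′ (OnArcs-l∈ xs on)) off′
    ... | inj₂ (inj₁ lr , _)   | inj₂ (inj₁ lr′ , _)    = r-injective (pairs-functional uniq lr lr′)
    ... | inj₂ (inj₂ rl , _)   | inj₂ (inj₂ rl′ , _)    = r-injective (pairs-injective uniq rl rl′)
    ... | inj₂ (inj₁ lr , Xuv) | inj₂ (inj₂ rl′ , Xuv′) = ⊥-elim (noArcPairOutside lr rl′ Xuv Xuv′)
    ... | inj₂ (inj₂ rl , Xuv) | inj₂ (inj₁ lr′ , Xuv′) = ⊥-elim (noArcPairOutside lr′ rl Xuv′ Xuv)

    rightUnique : ∀ u u′ v → (X ⊕ ps) u v ≡ true → (X ⊕ ps) u′ v ≡ true → u ≡ u′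
    rightUnique u u′ v X⊕uv X⊕u′v with ⊕-true X X⊕uv | ⊕-true X X⊕u′v
    ... | inj₁ (_ , Xuv) | inj₁ (_ , Xu′v) = proj₂ (proj₂ isMatching) u u′ v Xuv Xu′v
    ... | inj₁ (off , Xuv) | inj₂ (on′ , _) = contradiction (coverʳ Xuv (OnArcs-r∈ xs on′)) off
    ... | inj₂ (on , _) | inj₁ (off′ , Xu′v) = contradiction (coverʳ Xu′v (OnArcs-r∈ xs on)) off′
    ... | inj₂ (inj₁ lr , _)   | inj₂ (inj₁ lr′ , _)    = l-injective (pairs-injective uniq lr lr′)
    ... | inj₂ (inj₂ rl , _)   | inj₂ (inj₂ rl′ , _)    = l-injective (pairs-functional uniq rl rl′)
    ... | inj₂ (inj₁ lr , Xuv) | inj₂ (inj₂ rl′ , Xu′v) = ⊥-elim (noArcPairOutside lr rl′ Xuv Xu′v)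
    ... | inj₂ (inj₂ rl , Xuv) | inj₂ (inj₁ lr′ , Xu′v) = ⊥-elim (noArcPairOutside lr′ rl Xu′v Xuv)

-- The sum inside pathWeight is a local function of Defs; arcsWeight is the same sum over
-- an arbitrary arc list, which the inductions below need.
arcsWeight : (Fin a → Fin b → ℤ) → List (Arc a b) → ℤ
arcsWeight W []             = 0ℤ
arcsWeight W ((x , y) ∷ ps) = Wres W x y + arcsWeight W ps

pathWeight≡arcsWeight : (W : Fin a → Fin b → ℤ) (p : List (RV a b)) →
                        pathWeight W p ≡ arcsWeight W (arcs p)
pathWeight≡arcsWeight W []           = refl
pathWeight≡arcsWeight W (x ∷ [])     = refl
pathWeight≡arcsWeight W (x ∷ y ∷ p) =
  cong (λ w → 0ℤ + (Wres W x y + w))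
       (trans (sym (ℤ.+-identityˡ _)) (trans (pathWeight≡arcsWeight W (y ∷ p)) (ℤ.+-identityˡ _)))

weight-⊕-∷ : (W : Fin a → Fin b → ℤ) {E M X : EdgeSet a b} {x y : RV a b} {ps : List (Arc a b)} →
             REdge E M x y → (x , y) ∉ ps → Oriented X ((x , y) ∷ ps) →
             weight W (X ⊕ ((x , y) ∷ ps)) ≡ Wres W x y + weight W (X ⊕ ps)
weight-⊕-∷ W {X = X} {s} {l u} {ps} _ _ _ =
  trans (weight-cong W (λ _ _ → ⊕-∷-agree X {s , l u} {ps} (λ ()) (λ ()))) (sym (ℤ.+-identityˡ _))
weight-⊕-∷ W {X = X} {r v} {t} {ps} _ _ _ =
  trans (weight-cong W (λ _ _ → ⊕-∷-agree X {r v , t} {ps} (λ ()) (λ ()))) (sym (ℤ.+-identityˡ _))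
weight-⊕-∷ W {X = X} {l u} {r v} {ps} _ lr∉ oriented =
  weight-addEdge W u v
    (λ u′ v′ u′v′≢uv → ⊕-∷-agree X {l u , r v} {ps} (u′v′≢uv ∘ sym ∘ lr-injective) (λ ()))
    (trans (⊕-off X {ps} off) Xuv) (trans (⊕-on X {(l u , r v) ∷ ps} (inj₁ (here refl))) (cong not Xuv))
  where
  Xuv : X u v ≡ false
  Xuv = proj₁ oriented (here refl)
  off : ¬ OnArcs ps u v
  off (inj₁ lr) = lr∉ lr
  off (inj₂ rl) = contradiction (trans (sym (proj₂ oriented (there rl))) Xuv) λ ()
weight-⊕-∷ W {X = X} {r v} {l u} {ps} _ rl∉ oriented =
  y≈x\\z (W u v) _ _ (sym (weight-addEdge W u v
    (λ u′ v′ u′v′≢uv →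
       sym (⊕-∷-agree X {r v , l u} {ps} (λ ()) (u′v′≢uv ∘ sym ∘ rl-injective)))
    (trans (⊕-on X {(r v , l u) ∷ ps} (inj₂ (here refl))) (cong not Xuv)) (trans (⊕-off X {ps} off) Xuv)))
  where
  Xuv : X u v ≡ true
  Xuv = proj₂ oriented (here refl)
  off : ¬ OnArcs ps u v
  off (inj₁ lr) = contradiction (trans (sym (proj₁ oriented (there lr))) Xuv) λ ()
  off (inj₂ rl) = rl∉ rl

weight-⊕ : (W : Fin a → Fin b → ℤ) {E M X : EdgeSet a b} {xs : List (RV a b)} →
           Linked (REdge E M) xs → Unique xs → Oriented X (pairs xs) →
           weight W (X ⊕ pairs xs) ≡ arcsWeight W (pairs xs) + weight W X
weight-⊕ W []  _ _ = sym (ℤ.+-identityˡ _)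
weight-⊕ W [-] _ _ = sym (ℤ.+-identityˡ _)
weight-⊕ {a} {b} W {X = X} {x ∷ y ∷ zs} (xy ∷ linked) (x∉ ∷ uniq) oriented = begin
  weight W (X ⊕ ((x , y) ∷ ps))                 ≡⟨ weight-⊕-∷ W xy xy∉ oriented ⟩
  Wres W x y + weight W (X ⊕ ps)                ≡⟨ cong (_+_ (Wres W x y)) (weight-⊕ W linked uniq
                                                     (proj₁ oriented ∘ there , proj₂ oriented ∘ there)) ⟩
  Wres W x y + (arcsWeight W ps + weight W X)   ≡⟨ ℤ.+-assoc (Wres W x y) _ _ ⟨
  arcsWeight W ((x , y) ∷ ps) + weight W X      ∎
  where
  open ≡-Reasoning
  ps : List (Arc a b)
  ps = pairs (y ∷ zs)
  xy∉ : (x , y) ∉ ps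
  xy∉ xy∈ = All.lookup x∉ (pairs-∈ˡ (y ∷ zs) xy∈) refl

-- On every residual arc, Wres unitWeight x y ≡ leftSide x - leftSide y, so the unit weight
-- of a path ending in t telescopes to leftSide of its first vertex.
leftSide : RV a b → ℤ
leftSide s     = 1ℤ
leftSide (l _) = 1ℤ
leftSide (r _) = 0ℤ
leftSide t     = 0ℤ

arcsWeight-unitWeight : {E M : EdgeSet a b} (x : RV a b) (p : List (RV a b)) →
                        Linked (REdge E M) (x ∷ p ++ t ∷ []) →
                        arcsWeight unitWeight (pairs (x ∷ p ++ t ∷ [])) ≡ leftSide x
arcsWeight-unitWeight (r v) []      (_ ∷ [-])    = refl
arcsWeight-unitWeight s     []      (() ∷ _)
arcsWeight-unitWeight t     []      (() ∷ _)
arcsWeight-unitWeight (l u) []      (() ∷ _)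
arcsWeight-unitWeight {E = E} {M} x (y ∷ p) (xy ∷ linked) =
  trans (cong (_+_ (Wres unitWeight x y)) (arcsWeight-unitWeight y p linked)) (telescope x y xy)
  where
  telescope : ∀ x y → REdge E M x y → Wres unitWeight x y + leftSide y ≡ leftSide x
  telescope s     (l _) _ = refl
  telescope (l _) (r _) _ = refl
  telescope (r _) (l _) _ = refl
  telescope (r _) t     _ = refl

size-⊕ : {E M X : EdgeSet a b} {p : List (RV a b)} → IsSTPath E M p → Oriented X (arcs p) →
         size (X ⊕ arcs p) ≡ suc (size X)
size-⊕ {X = X} {p} (linked , uniq) oriented = ℤ.+-injective (begin
  + size (X ⊕ arcs p)                                   ≡⟨ weight-unitWeight (X ⊕ arcs p) ⟨
  weight unitWeight (X ⊕ arcs p)                        ≡⟨ weight-⊕ unitWeight linked uniq oriented ⟩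
  arcsWeight unitWeight (arcs p) + weight unitWeight X  ≡⟨ cong₂ _+_ (arcsWeight-unitWeight s p linked)
                                                                     (weight-unitWeight X) ⟩
  1ℤ + + size X                                         ∎)
  where open ≡-Reasoning

-- Augmenting paths of the residual graph

module _ {E M : EdgeSet a b} {p : List (RV a b)} (path : IsSTPath E M p) where

  arc-REdge : ∀ {x y} → (x , y) ∈ arcs p → REdge E M x y
  arc-REdge = pairs-Linked (proj₁ path)

  path-Oriented : Oriented M (arcs p)
  path-Oriented = (λ lr → proj₂ (arc-REdge lr)) , arc-REdge

  OnArcs⊆E : (∀ u v → M u v ≡ true → E u v ≡ true) →
             ∀ {u v} → OnArcs (arcs p) u v → E u v ≡ true
  OnArcs⊆E _   (inj₁ lr) = proj₁ (arc-REdge lr)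
  OnArcs⊆E M⊆E (inj₂ rl) = M⊆E _ _ (arc-REdge rl)

  arc-target : ∀ {x y} → (x , y) ∈ arcs p → y ∈ fullPath p
  arc-target = pairs-∈ʳ (fullPath p)

  leftInner : ∀ {u} → l u ∈ fullPath p → l u ∈ p
  leftInner lu∈ = inner p lu∈ (λ ()) (λ ())

  rightInner : ∀ {v} → r v ∈ fullPath p → r v ∈ p
  rightInner rv∈ = inner p rv∈ (λ ()) (λ ())

  left-out : ∀ {u} → l u ∈ p → ∃ λ v → (l u , r v) ∈ arcs p
  left-out lu∈ = out (proj₂ (successor p lu∈)) (arc-REdge (proj₂ (successor p lu∈)))
    where
    out : ∀ {u y} → (l u , y) ∈ arcs p → REdge E M (l u) y → ∃ λ v → (l u , r v) ∈ arcs p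
    out {y = r v} lr _ = v , lr

  right-in : ∀ {v} → r v ∈ p → ∃ λ u → (l u , r v) ∈ arcs p
  right-in rv∈ = into (proj₂ (predecessor p rv∈)) (arc-REdge (proj₂ (predecessor p rv∈)))
    where
    into : ∀ {v y} → (y , r v) ∈ arcs p → REdge E M y (r v) → ∃ λ u → (l u , r v) ∈ arcs p
    into {y = l u} lr _ = u , lr

  left-in : ∀ {u} → l u ∈ p → (s , l u) ∈ arcs p ⊎ ∃ λ v → (r v , l u) ∈ arcs p
  left-in lu∈ = into (proj₂ (predecessor p lu∈)) (arc-REdge (proj₂ (predecessor p lu∈)))
    where
    into : ∀ {u y} → (y , l u) ∈ arcs p → REdge E M y (l u) →
           (s , l u) ∈ arcs p ⊎ ∃ λ v → (r v , l u) ∈ arcs p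
    into {y = s}   su _ = inj₁ su
    into {y = r v} rl _ = inj₂ (v , rl)

  right-out : ∀ {v} → r v ∈ p → (r v , t) ∈ arcs p ⊎ ∃ λ u → (r v , l u) ∈ arcs p
  right-out rv∈ = out (proj₂ (successor p rv∈)) (arc-REdge (proj₂ (successor p rv∈)))
    where
    out : ∀ {v y} → (r v , y) ∈ arcs p → REdge E M (r v) y →
          (r v , t) ∈ arcs p ⊎ ∃ λ u → (r v , l u) ∈ arcs p
    out {y = t}   vt _ = inj₁ vt
    out {y = l u} rl _ = inj₂ (u , rl)

  freeLeft-entered : ∀ {u} → (∀ v → M u v ≡ false) → l u ∈ p → (s , l u) ∈ arcs p
  freeLeft-entered uFree lu∈ with left-in lu∈
  ... | inj₁ su       = su
  ... | inj₂ (v , rl) = contradiction (trans (sym (arc-REdge rl)) (uFree v)) λ ()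

  freeRight-exits : ∀ {v} → (∀ u → M u v ≡ false) → r v ∈ p → (r v , t) ∈ arcs p
  freeRight-exits vFree rv∈ with right-out rv∈
  ... | inj₁ vt       = vt
  ... | inj₂ (u , rl) = contradiction (trans (sym (arc-REdge rl)) (vFree u)) λ ()

  augment-isMatching : IsMatching E M → IsMatching E (M ⊕ arcs p)
  augment-isMatching isM@(M⊆E , leftUnique , rightUnique) =
    ⊕-isMatching (proj₂ path) isM (OnArcs⊆E M⊆E) coverˡ coverʳ (inj₁ path-Oriented)
    where
    coverˡ : ∀ {u v} → M u v ≡ true → l u ∈ fullPath p → OnArcs (arcs p) u v
    coverˡ {u} {v} Muv lu∈ with left-in (leftInner lu∈)
    ... | inj₁ su = contradiction (trans (sym Muv) (arc-REdge su v)) λ ()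
    ... | inj₂ (v′ , rl) with leftUnique u v v′ Muv (arc-REdge rl)
    ...   | refl = inj₂ rl

    coverʳ : ∀ {u v} → M u v ≡ true → r v ∈ fullPath p → OnArcs (arcs p) u v
    coverʳ {u} {v} Muv rv∈ with right-out (rightInner rv∈)
    ... | inj₁ vt = contradiction (trans (sym Muv) (arc-REdge vt u)) λ ()
    ... | inj₂ (u′ , rl) with rightUnique u u′ v Muv (arc-REdge rl)
    ...   | refl = inj₂ rl

  size-augment : size (M ⊕ arcs p) ≡ suc (size M)
  size-augment = size-⊕ path path-Oriented

  augment-sizeMatching : ∀ {k} → SizeMatching E k M → SizeMatching E (suc k) (M ⊕ arcs p)
  augment-sizeMatching (isM , |M|≡) = augment-isMatching isM , trans size-augment (cong suc |M|≡)

  weight-augment : (W : Fin a → Fin b → ℤ) → weight W (M ⊕ arcs p) ≡ pathWeight W p + weight W M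
  weight-augment W = trans (weight-⊕ W (proj₁ path) (proj₂ path) path-Oriented)
                           (cong (λ w → w + weight W M) (sym (pathWeight≡arcsWeight W p)))

  module _ {M′ : EdgeSet a b} (antioriented : Antioriented M′ (arcs p)) where

    reduce-isMatching : (∀ u v → M u v ≡ true → E u v ≡ true) → IsMatching E M′ →
                        IsMatching E (M′ ⊕ arcs p)
    reduce-isMatching M⊆E isM′@(_ , leftUnique , rightUnique) =
      ⊕-isMatching (proj₂ path) isM′ (OnArcs⊆E M⊆E) coverˡ coverʳ (inj₂ antioriented)
      where
      coverˡ : ∀ {u v} → M′ u v ≡ true → l u ∈ fullPath p → OnArcs (arcs p) u v
      coverˡ {u} {v} M′uv lu∈ with left-out (leftInner lu∈)
      ... | v′ , lr with leftUnique u v v′ M′uv (proj₁ antioriented lr)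
      ...   | refl = inj₁ lr

      coverʳ : ∀ {u v} → M′ u v ≡ true → r v ∈ fullPath p → OnArcs (arcs p) u v
      coverʳ {u} {v} M′uv rv∈ with right-in (rightInner rv∈)
      ... | u′ , lr with rightUnique u u′ v M′uv (proj₁ antioriented lr)
      ...   | refl = inj₁ lr

    private
      reduced-Oriented : Oriented (M′ ⊕ arcs p) (arcs p)
      reduced-Oriented = ⊕-Oriented M′ (arcs p) antioriented

    size-reduce : size M′ ≡ suc (size (M′ ⊕ arcs p))
    size-reduce = trans (size-cong (λ u v → sym (⊕-involutive M′ (arcs p) u v)))
                        (size-⊕ path reduced-Oriented)

    weight-reduce : (W : Fin a → Fin b → ℤ) → weight W M′ ≡ pathWeight W p + weight W (M′ ⊕ arcs p)
    weight-reduce W = begin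
      weight W M′
        ≡⟨ weight-cong W (λ u v → sym (⊕-involutive M′ (arcs p) u v)) ⟩
      weight W ((M′ ⊕ arcs p) ⊕ arcs p)
        ≡⟨ weight-⊕ W (proj₁ path) (proj₂ path) reduced-Oriented ⟩
      arcsWeight W (arcs p) + weight W (M′ ⊕ arcs p)
        ≡⟨ cong (λ w → w + weight W (M′ ⊕ arcs p)) (pathWeight≡arcsWeight W p) ⟨
      pathWeight W p + weight W (M′ ⊕ arcs p)
        ∎
      where open ≡-Reasoning

augment-cong : (M : EdgeSet a b) {p q : List (RV a b)} → p ≈ₚ q → (M ⊕ arcs p) ≐ (M ⊕ arcs q)
augment-cong M p≈q u v = ⊕-cong M (p≈q (l u) (r v) ⊎-⇔ p≈q (r v) (l u))

module _ {E M : EdgeSet a b} {p q : List (RV a b)} (pathₚ : IsSTPath E M p) (path₍q₎ : IsSTPath E M q)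
         (same : (M ⊕ arcs p) ≐ (M ⊕ arcs q)) where

  private
    lr-transfer : ∀ {u v} → (l u , r v) ∈ arcs p → (l u , r v) ∈ arcs q
    lr-transfer {u} {v} lr with ⊕-reflects-OnArcs M (same u v) (inj₁ lr)
    ... | inj₁ lr′ = lr′
    ... | inj₂ rl′ =
      contradiction (trans (sym (arc-REdge path₍q₎ rl′)) (proj₂ (arc-REdge pathₚ lr))) λ ()

    rl-transfer : ∀ {u v} → (r v , l u) ∈ arcs p → (r v , l u) ∈ arcs q
    rl-transfer {u} {v} rl with ⊕-reflects-OnArcs M (same u v) (inj₂ rl)
    ... | inj₁ lr′ =
      contradiction (trans (sym (arc-REdge pathₚ rl)) (proj₂ (arc-REdge path₍q₎ lr′))) λ ()
    ... | inj₂ rl′ = rl′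

    left-transfer : ∀ {u} → l u ∈ p → l u ∈ q
    left-transfer lu∈ =
      leftInner path₍q₎ (OnArcs-l∈ (fullPath q) (inj₁ (lr-transfer (proj₂ (left-out pathₚ lu∈)))))

    right-transfer : ∀ {v} → r v ∈ p → r v ∈ q
    right-transfer rv∈ =
      rightInner path₍q₎ (OnArcs-r∈ (fullPath q) (inj₁ (lr-transfer (proj₂ (right-in pathₚ rv∈)))))

    transfer : ∀ {x y} → (x , y) ∈ arcs p → REdge E M x y → (x , y) ∈ arcs q
    transfer {l _} {r _} lr _ = lr-transfer lr
    transfer {r _} {l _} rl _ = rl-transfer rl
    transfer {s} {l _} su uFree =
      freeLeft-entered path₍q₎ uFree (left-transfer (leftInner pathₚ (arc-target pathₚ su)))
    transfer {r _} {t} vt vFree =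
      freeRight-exits path₍q₎ vFree (right-transfer (rightInner pathₚ (pairs-∈ˡ (fullPath p) vt)))

  augment-arcs-⊆ : ∀ {x y} → (x , y) ∈ arcs p → (x , y) ∈ arcs q
  augment-arcs-⊆ xy = transfer xy (arc-REdge pathₚ xy)

augment-injective : {E M : EdgeSet a b} {p q : List (RV a b)} → IsSTPath E M p → IsSTPath E M q →
                    (M ⊕ arcs p) ≐ (M ⊕ arcs q) → p ≈ₚ q
augment-injective pathₚ path₍q₎ same x y =
  mk⇔ (augment-arcs-⊆ pathₚ path₍q₎ same) (augment-arcs-⊆ path₍q₎ pathₚ (λ u v → sym (same u v)))

-- Augmenting paths inside a larger matching

exposedCoveredVertex : {E M M′ : EdgeSet a b} → IsMatching E M′ → size M ℕ.< size M′ →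
                       ∃ λ u → (∃ λ v → M′ u v ≡ true) × (∀ v → M u v ≡ false)
exposedCoveredVertex {a} {b} {M = M} {M′} (_ , leftUnique′ , _) M<M′
  with any? (λ u → any? (λ v → M′ u v ≟ᵇ true) ×-dec all? (λ v → M u v ≟ᵇ false))
... | yes found = found
... | no  none  = contradiction (sumℕ-mono-≤ a rowBound) (ℕ.<⇒≱ M<M′)
  where
  rowBound : ∀ u → count b (M′ u) ℕ.≤ count b (M u)
  rowBound u with any? (λ v → M u v ≟ᵇ true)
  ... | yes (v , Muv) = ℕ.≤-trans (count-≤1 b (M′ u) (leftUnique′ u))
                          (subst (ℕ._≤ count b (M u)) (cong (λ c → if c then 1 else 0) Muv) (sumℕ-≥ b _ v))
  ... | no  uBusy     = ℕ.≤-reflexive (trans (count-none b (M′ u) M′-free) (sym (count-none b (M u) M-free)))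
    where
    M-free : ∀ v → M u v ≡ false
    M-free v = ¬-not (λ Muv → uBusy (v , Muv))
    M′-free : ∀ v → M′ u v ≡ false
    M′-free v = ¬-not (λ M′uv → none (u , (v , M′uv) , M-free))

module _ {E M : EdgeSet a b} {u₀ : Fin a} {v₀ : Fin b} where

  REdge-∖ : ∀ {x y} → x ≢ s → x ≢ r v₀ → y ≢ r v₀ →
            REdge E (M ∖ (u₀ , v₀)) x y → REdge E M x y
  REdge-∖ {s}   {l _} s≢s _ _ = contradiction refl s≢s
  REdge-∖ {l u} {r v} _ _ y≢rv₀ (Euv , M₀uv) =
    Euv , trans (sym (∖-other M (λ eq → y≢rv₀ (cong (r ∘ proj₂) eq)))) M₀uv
  REdge-∖ {r v} {l u} _ _ _ M₀uv = ∖-⊆ M (u₀ , v₀) u v M₀uv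
  REdge-∖ {r v} {t}   _ x≢rv₀ _ vFree₀ u =
    trans (sym (∖-other M (λ eq → x≢rv₀ (cong (r ∘ proj₂) eq)))) (vFree₀ u)

  REdge-∖-source : ∀ {u} → u ≢ u₀ → REdge E (M ∖ (u₀ , v₀)) s (l u) → REdge E M s (l u)
  REdge-∖-source u≢u₀ uFree₀ v = trans (sym (∖-other M (u≢u₀ ∘ cong proj₁))) (uFree₀ v)

  Linked-∖ : ∀ {ys} → All (s ≢_) ys → All (r v₀ ≢_) ys →
             Linked (REdge E (M ∖ (u₀ , v₀))) ys → Linked (REdge E M) ys
  Linked-∖ {ys} s∉ rv₀∉ = Linked-map∈ λ xy →
    REdge-∖ (All.lookup s∉ (pairs-∈ˡ ys xy) ∘ sym)
            (All.lookup rv₀∉ (pairs-∈ˡ ys xy) ∘ sym) (All.lookup rv₀∉ (pairs-∈ʳ ys xy) ∘ sym)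

module _ {E M X : EdgeSet a b} {p : List (RV a b)} {u : Fin a} {v : Fin b} (path : IsSTPath E M p) where

  ∖-avoided : IsMatching E X → X u v ≡ true → Antioriented (X ∖ (u , v)) (arcs p) → l u ∉ p × r v ∉ p
  ∖-avoided (_ , leftUnique , rightUnique) Xuv (lr⊆X₀ , _) = lu∉ , rv∉
    where
    deleted : (X ∖ (u , v)) u v ≡ true → ⊥
    deleted X₀uv = contradiction (trans (sym X₀uv) (∖-self X u v)) λ ()
    lu∉ : l u ∉ p
    lu∉ lu∈ with left-out path lu∈
    ... | v′ , lr with leftUnique u v v′ Xuv (∖-⊆ X (u , v) u v′ (lr⊆X₀ lr))
    ...   | refl = deleted (lr⊆X₀ lr)
    rv∉ : r v ∉ p
    rv∉ rv∈ with right-in path rv∈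
    ... | u′ , lr with rightUnique u u′ v Xuv (∖-⊆ X (u , v) u′ v (lr⊆X₀ lr))
    ...   | refl = deleted (lr⊆X₀ lr)

  Antioriented-∖ : Antioriented (X ∖ (u , v)) (arcs p) → l u ∉ p → Antioriented X (arcs p)
  Antioriented-∖ (lr⊆X₀ , rl⊈X₀) lu∉ =
    (λ {u′} {v′} lr → ∖-⊆ X (u , v) u′ v′ (lr⊆X₀ lr)) ,
    (λ {u′} rl → trans (sym (∖-other X (λ eq → lu∉ (subst (λ w → l w ∈ p) (cong proj₁ eq)
                                                       (leftInner path (arc-target path rl))))))
                       (rl⊈X₀ rl))

AugmentingPath : (E M M′ : EdgeSet a b) → Set
AugmentingPath E M M′ = ∃ λ p → IsSTPath E M p × Antioriented M′ (arcs p)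

singleEdgePath : {E M M′ : EdgeSet a b} {u : Fin a} {v : Fin b} → E u v ≡ true → M′ u v ≡ true →
                 (∀ v′ → M u v′ ≡ false) → (∀ u′ → M u′ v ≡ false) → AugmentingPath E M M′
singleEdgePath Euv M′uv uFree vFree =
  (l _ ∷ r _ ∷ []) ,
  (uFree ∷ (Euv , uFree _) ∷ vFree ∷ [-] ,
   ((λ ()) ∷ (λ ()) ∷ (λ ()) ∷ []) ∷ ((λ ()) ∷ (λ ()) ∷ []) ∷ ((λ ()) ∷ []) ∷ [] ∷ []) ,
  (λ { (there (here refl)) → M′uv ; (there (there (there ()))) }) ,
  (λ { (there (there (there ()))) })

module _ {E M M′ : EdgeSet a b} {u u″ : Fin a} {v : Fin b} (isM′ : IsMatching E M′)
         (M′uv : M′ u v ≡ true) (uFree : ∀ v′ → M u v′ ≡ false) (Mu″v : M u″ v ≡ true) where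

  extendAugmentingPath : AugmentingPath E (M ∖ (u″ , v)) (M′ ∖ (u , v)) → AugmentingPath E M M′
  extendAugmentingPath ([] , (() ∷ _ , _) , _)
  extendAugmentingPath (l x ∷ rest , path₀@(sx ∷ linked₀ , s∉ ∷ uniq) , antioriented₀) =
    extend (x ≟ᶠ u″)
    where
    tail : List (RV a b)
    tail = l x ∷ rest ++ t ∷ []

    avoided : l u ∉ l x ∷ rest × r v ∉ l x ∷ rest
    avoided = ∖-avoided path₀ isM′ M′uv antioriented₀

    lu∉tail : l u ∉ tail
    lu∉tail = ∉-snoc (proj₁ avoided) λ ()

    rv∉tail : r v ∉ tail
    rv∉tail = ∉-snoc (proj₂ avoided) λ ()

    linked : Linked (REdge E M) tail
    linked = Linked-∖ s∉ (¬Any⇒All¬ tail rv∉tail) linked₀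

    antioriented : Antioriented M′ (arcs (l x ∷ rest))
    antioriented = Antioriented-∖ path₀ antioriented₀ (proj₁ avoided)

    M-edge-∉M′ : M x v ≡ true → M′ x v ≡ false
    M-edge-∉M′ Mxv = ¬-not λ M′xv →
      contradiction (trans (sym (subst (λ w → M w v ≡ true) (proj₂ (proj₂ isM′) x u v M′xv M′uv) Mxv))
                           (uFree v)) λ ()

    extend : Dec (x ≡ u″) → AugmentingPath E M M′
    extend (no x≢u″) =
      (l x ∷ rest) , (REdge-∖-source {E = E} {M = M} x≢u″ sx ∷ linked , s∉ ∷ uniq) , antioriented
    extend (yes x≡u″) =
      (l u ∷ r v ∷ l x ∷ rest) ,
      (uFree ∷ (proj₁ isM′ u v M′uv , uFree v) ∷ Mxv ∷ linked ,
       ((λ ()) ∷ (λ ()) ∷ s∉) ∷ ((λ ()) ∷ ¬Any⇒All¬ tail lu∉tail) ∷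
       ¬Any⇒All¬ tail rv∉tail ∷ uniq) ,
      (λ { (there (here refl)) → M′uv
         ; (there (there (there lr))) → proj₁ antioriented (there lr) }) ,
      (λ { (there (there (here refl))) → M-edge-∉M′ Mxv
         ; (there (there (there rl))) → proj₂ antioriented (there rl) })
      where
      Mxv : M x v ≡ true
      Mxv = subst (λ w → M w v ≡ true) (sym x≡u″) Mu″v

augmentingPath : ∀ n {E M M′ : EdgeSet a b} → size M ℕ.< n → IsMatching E M → IsMatching E M′ →
                 size M ℕ.< size M′ → AugmentingPath E M M′
augmentingPath (suc n) {E} {M} {M′} M<n isM isM′ M<M′ with exposedCoveredVertex isM′ M<M′
... | u , (v , M′uv) , uFree with any? (λ u″ → M u″ v ≟ᵇ true)
...   | no  vBusy =
          singleEdgePath (proj₁ isM′ u v M′uv) M′uv uFree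
            (λ u′ → ¬-not (λ Mu′v → vBusy (u′ , Mu′v)))
...   | yes (u″ , Mu″v) = extendAugmentingPath isM′ M′uv uFree Mu″v
          (augmentingPath n (s<s⁻¹ (subst (ℕ._< suc n) (size-∖ M u″ v Mu″v) M<n))
             (IsMatching-⊆ (∖-⊆ M (u″ , v)) isM) (IsMatching-⊆ (∖-⊆ M′ (u , v)) isM′)
             (s<s⁻¹ (subst₂ ℕ._<_ (size-∖ M u″ v Mu″v) (size-∖ M′ u v M′uv) M<M′)))

-- Isolation of matchings and of augmenting paths

module _ {E : EdgeSet a b} (W : Fin a → Fin b → ℤ) {k : ℕ} {M : EdgeSet a b}
         (isolated : IsolatedBy (SizeMatching E k) _≐_ (weight W) M) where

  private
    isM : IsMatching E M
    isM = proj₁ (proj₁ isolated)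
    M-min : ∀ Y → SizeMatching E k Y → weight W M ≤ weight W Y
    M-min = proj₁ (proj₂ isolated)
    M-unique : ∀ Y → SizeMatching E k Y → weight W Y ≡ weight W M → Y ≐ M
    M-unique = proj₂ (proj₂ isolated)

  bound-along : ∀ {M′ p} → SizeMatching E (suc k) M′ → IsSTPath E M p → Antioriented M′ (arcs p) →
    pathWeight W p + weight W M ≤ weight W M′ ×
    (pathWeight W p + weight W M ≡ weight W M′ → M′ ≐ (M ⊕ arcs p))
  bound-along {M′} {p} (isM′ , |M′|≡) path antioriented = bound , tight
    where
    Y : EdgeSet a b
    Y = M′ ⊕ arcs p
    Y-sizeMatching : SizeMatching E k Y
    Y-sizeMatching = reduce-isMatching path antioriented (proj₁ isM) isM′ ,
                     ℕ.suc-injective (trans (sym (size-reduce path antioriented)) |M′|≡)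
    weight-M′ : weight W M′ ≡ pathWeight W p + weight W Y
    weight-M′ = weight-reduce path antioriented W
    bound : pathWeight W p + weight W M ≤ weight W M′
    bound = subst (pathWeight W p + weight W M ≤_) (sym weight-M′)
                  (ℤ.+-monoʳ-≤ (pathWeight W p) (M-min Y Y-sizeMatching))
    tight : pathWeight W p + weight W M ≡ weight W M′ → M′ ≐ (M ⊕ arcs p)
    tight eq = ≐-trans (λ u v → sym (⊕-involutive M′ (arcs p) u v)) (⊕-congˡ (arcs p) Y≐M)
      where
      Y≐M : Y ≐ M
      Y≐M = M-unique Y Y-sizeMatching (∙-cancelˡ (pathWeight W p) _ _ (trans (sym weight-M′) (sym eq)))

  augmentation-bound : ∀ {M′} → SizeMatching E (suc k) M′ →
    ∃ λ p → IsSTPath E M p × pathWeight W p + weight W M ≤ weight W M′ ×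
            (pathWeight W p + weight W M ≡ weight W M′ → M′ ≐ (M ⊕ arcs p))
  augmentation-bound {M′} M′-sizeMatching@(isM′ , |M′|≡) =
    let p , path , antioriented = augmentingPath (suc (size M)) (ℕ.n<1+n (size M)) isM isM′ M<M′
    in  p , path , bound-along M′-sizeMatching path antioriented
    where
    M<M′ : size M ℕ.< size M′
    M<M′ = subst₂ ℕ._<_ (sym (proj₂ (proj₁ isolated))) (sym |M′|≡) (ℕ.n<1+n k)

lemma4p4 : (a b : ℕ) (E : EdgeSet a b) (W : Fin a → Fin b → ℤ) (k : ℕ)
    (M : EdgeSet a b) →
    IsolatedBy (SizeMatching E k) _≐_ (weight W) M →
    Isolates (SizeMatching E (suc k)) _≐_ (weight W)
      ⇔ Isolates (IsSTPath E M) _≈ₚ_ (pathWeight W)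
lemma4p4 a b E W k M isolated =
  isolates-transfer (weight W M) (λ p → M ⊕ arcs p) ≐-trans
    (λ path → augment-sizeMatching path (proj₁ isolated))
    (λ path → weight-augment path W)
    (augment-cong M)
    augment-injective
    (augmentation-bound W isolated)
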